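{- Let $\mathcal{A}$ be a set of games and $G,H$ augmented forms with $G\geq_{\mathcal{A}}H$. If $H$ is Left end-like, then $G$ is Left $\mathcal{A}$-strong; and if $G$ is Right end-like, then $H$ is Right $\mathcal{A}$-strong.
   Context: Games are short partizan game forms under the misère convention (a player unable to move wins); $o_L(G)$ (resp. $o_R(G)$) $\in\{\mathscr{L},\mathscr{R}\}$ is the winner when Left (resp. Right) moves first; outcome classes are ordered $\mathscr{L}>\mathscr{N}>\mathscr{R}$, $\mathscr{L}>\mathscr{P}>\mathscr{R}$. Augmented forms (Siegel): game forms in which each subposition may carry a Left and/or Right tombstone (formal markers, not options). An augmented form is Left end-like if it has no Left options or carries a Left tombstone (Right end-like symmetrically); a player to move on a position that is end-like for them wins immediately; $G+H$ carries a Left tombstone iff both are Left end-like and at least one carries a Left tombstone (symmetrically for Right). For a set of games $\mathcal{A}$, $G\geq_{\mathcal{A}}H$ means $o(G+X)\geq o(H+X)$ for all $X\in\mathcal{A}$. $G$ is Left $\mathcal{A}$-strong if $o_L(G+X)=\mathscr{L}$ for every Left end (game with no Left options) $X\in\mathcal{A}$; Right $\mathcal{A}$-strong if $o_R(G+X)=\mathscr{R}$ for every Right end $X\in\mathcal{A}$. -}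

module Defs where

open import Data.Bool using (Bool; true; false; _∧_; _∨_; not)
open import Data.List using (List; []; _∷_; _++_)
open import Data.Product using (_×_)
open import Relation.Binary.PropositionalEquality using (_≡_)

data Player : Set where
  Left Right : Player

data Game : Set where
  ⟨_∣_⟩ : List Game → List Game → Game

-- Augmented forms: each subposition may carry a Left and/or Right tombstone.
-- aform ltomb rtomb leftOptions rightOptions
data AForm : Set where
  aform : Bool → Bool → List AForm → List AForm → AForm

mutual
  embed : Game → AForm
  embed ⟨ GL ∣ GR ⟩ = aform false false (embedList GL) (embedList GR)

  embedList : List Game → List AForm
  embedList [] = []
  embedList (g ∷ gs) = embed g ∷ embedList gs

isNil : {A : Set} → List A → Bool
isNil [] = true
isNil (_ ∷ _) = false

leftEndLikeᵇ : AForm → Bool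
leftEndLikeᵇ (aform lt _ GL _) = lt ∨ isNil GL

rightEndLikeᵇ : AForm → Bool
rightEndLikeᵇ (aform _ rt _ GR) = rt ∨ isNil GR

leftTombᵇ : AForm → Bool
leftTombᵇ (aform lt _ _ _) = lt

rightTombᵇ : AForm → Bool
rightTombᵇ (aform _ rt _ _) = rt

LeftEndLike : AForm → Set
LeftEndLike G = leftEndLikeᵇ G ≡ true

RightEndLike : AForm → Set
RightEndLike G = rightEndLikeᵇ G ≡ true

LeftEnd : Game → Set
LeftEnd ⟨ GL ∣ _ ⟩ = GL ≡ []

RightEnd : Game → Set
RightEnd ⟨ _ ∣ GR ⟩ = GR ≡ []

mutual
  _+_ : AForm → AForm → AForm
  G@(aform lg rg GL GR) + H@(aform lh rh HL HR) =
    aform ((leftEndLikeᵇ G ∧ leftEndLikeᵇ H) ∧ (lg ∨ lh))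
          ((rightEndLikeᵇ G ∧ rightEndLikeᵇ H) ∧ (rg ∨ rh))
          (sumL GL H ++ sumR G HL)
          (sumL GR H ++ sumR G HR)

  sumL : List AForm → AForm → List AForm
  sumL [] H = []
  sumL (g ∷ gs) H = (g + H) ∷ sumL gs H

  sumR : AForm → List AForm → List AForm
  sumR G [] = []
  sumR G (h ∷ hs) = (G + h) ∷ sumR G hs

infixl 6 _+_

-- Misère play with tombstones: a player to move on a position that is
-- end-like for them wins immediately; otherwise they win iff some option
-- wins for them with the opponent to move.
mutual
  leftWinsFirst : AForm → Bool
  leftWinsFirst G@(aform _ _ GL _) = leftEndLikeᵇ G ∨ anyLeftWin GL

  rightWinsFirst : AForm → Bool
  rightWinsFirst G@(aform _ _ _ GR) = rightEndLikeᵇ G ∨ anyRightWin GR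

  anyLeftWin : List AForm → Bool
  anyLeftWin [] = false
  anyLeftWin (g ∷ gs) = not (rightWinsFirst g) ∨ anyLeftWin gs

  anyRightWin : List AForm → Bool
  anyRightWin [] = false
  anyRightWin (g ∷ gs) = not (leftWinsFirst g) ∨ anyRightWin gs

oL : AForm → Player
oL G with leftWinsFirst G
... | true = Left
... | false = Right

oR : AForm → Player
oR G with rightWinsFirst G
... | true = Right
... | false = Left

data Outcome : Set where
  𝓛 𝓝 𝓟 𝓡 : Outcome

outcomeOf : Player → Player → Outcome
outcomeOf Left  Left  = 𝓛
outcomeOf Left  Right = 𝓝
outcomeOf Right Left  = 𝓟
outcomeOf Right Right = 𝓡

o : AForm → Outcome
o G = outcomeOf (oL G) (oR G)

data _≥ₒ_ : Outcome → Outcome → Set where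
  refl≥ : ∀ {x} → x ≥ₒ x
  𝓛≥𝓝 : 𝓛 ≥ₒ 𝓝
  𝓛≥𝓟 : 𝓛 ≥ₒ 𝓟
  𝓛≥𝓡 : 𝓛 ≥ₒ 𝓡
  𝓝≥𝓡 : 𝓝 ≥ₒ 𝓡
  𝓟≥𝓡 : 𝓟 ≥ₒ 𝓡

_≥[_]_ : AForm → (Game → Set) → AForm → Set
G ≥[ 𝒜 ] H = ∀ (X : Game) → 𝒜 X → o (G + embed X) ≥ₒ o (H + embed X)

LeftStrong : (Game → Set) → AForm → Set
LeftStrong 𝒜 G = ∀ (X : Game) → 𝒜 X → LeftEnd X → oL (G + embed X) ≡ Left

RightStrong : (Game → Set) → AForm → Set
RightStrong 𝒜 G = ∀ (X : Game) → 𝒜 X → RightEnd X → oR (G + embed X) ≡ Right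

{-# OPTIONS --safe #-}
-- If H is Left end-like and X is a Left end, then H + X is Left end-like, so
-- Left wins H + X immediately when moving first; G ≥ H on X then forces Left
-- to win G + X moving first as well.  The Right half is dual, with the roles
-- of G and H exchanged.
module Submission where

open import Defs
open import Data.Bool using (true; false)
open import Data.List using ([]; _∷_)
open import Data.Product using (_×_; _,_)
open import Relation.Binary.PropositionalEquality using (_≡_; refl)

embed-leftEnd : ∀ X → LeftEnd X → LeftEndLike (embed X)
embed-leftEnd ⟨ .[] ∣ _ ⟩ refl = refl

embed-rightEnd : ∀ X → RightEnd X → RightEndLike (embed X)
embed-rightEnd ⟨ _ ∣ .[] ⟩ refl = refl

leftEndLike-+ : ∀ G X → LeftEndLike G → LeftEndLike X → LeftEndLike (G + X)
leftEndLike-+ (aform true  _ _  _) (aform true  _ _  _) _ _ = refl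
leftEndLike-+ (aform true  _ _  _) (aform false _ [] _) _ _ = refl
leftEndLike-+ (aform false _ [] _) (aform true  _ _  _) _ _ = refl
leftEndLike-+ (aform false _ [] _) (aform false _ [] _) _ _ = refl
leftEndLike-+ (aform false _ (_ ∷ _) _) _ () _
leftEndLike-+ (aform true  _ _  _) (aform false _ (_ ∷ _) _) _ ()
leftEndLike-+ (aform false _ [] _) (aform false _ (_ ∷ _) _) _ ()

rightEndLike-+ : ∀ G X → RightEndLike G → RightEndLike X → RightEndLike (G + X)
rightEndLike-+ (aform _ true  _ _ ) (aform _ true  _ _ ) _ _ = refl
rightEndLike-+ (aform _ true  _ _ ) (aform _ false _ []) _ _ = refl
rightEndLike-+ (aform _ false _ []) (aform _ true  _ _ ) _ _ = refl
rightEndLike-+ (aform _ false _ []) (aform _ false _ []) _ _ = refl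
rightEndLike-+ (aform _ false _ (_ ∷ _)) _ () _
rightEndLike-+ (aform _ true  _ _ ) (aform _ false _ (_ ∷ _)) _ ()
rightEndLike-+ (aform _ false _ []) (aform _ false _ (_ ∷ _)) _ ()

leftEndLike⇒oL≡Left : ∀ G → LeftEndLike G → oL G ≡ Left
leftEndLike⇒oL≡Left (aform _ _ _ _) e rewrite e = refl

rightEndLike⇒oR≡Right : ∀ G → RightEndLike G → oR G ≡ Right
rightEndLike⇒oR≡Right (aform _ _ _ _) e rewrite e = refl

≥ₒ-preserves-oL≡Left : ∀ {a b a′ b′} →
  outcomeOf a b ≥ₒ outcomeOf a′ b′ → a′ ≡ Left → a ≡ Left
≥ₒ-preserves-oL≡Left {Left} _ _ = refl
≥ₒ-preserves-oL≡Left {Right} {Left}  {b′ = Left}  () refl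
≥ₒ-preserves-oL≡Left {Right} {Left}  {b′ = Right} () refl
≥ₒ-preserves-oL≡Left {Right} {Right} {b′ = Left}  () refl
≥ₒ-preserves-oL≡Left {Right} {Right} {b′ = Right} () refl

≥ₒ-reflects-oR≡Right : ∀ {a b a′ b′} →
  outcomeOf a b ≥ₒ outcomeOf a′ b′ → b ≡ Right → b′ ≡ Right
≥ₒ-reflects-oR≡Right {b′ = Right} _ _ = refl
≥ₒ-reflects-oR≡Right {Left}  {a′ = Left}  {Left} () refl
≥ₒ-reflects-oR≡Right {Left}  {a′ = Right} {Left} () refl
≥ₒ-reflects-oR≡Right {Right} {a′ = Left}  {Left} () refl
≥ₒ-reflects-oR≡Right {Right} {a′ = Right} {Left} () refl

proposition2p3 : (𝒜 : Game → Set) (G H : AForm) → G ≥[ 𝒜 ] H →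
    (LeftEndLike H → LeftStrong 𝒜 G) × (RightEndLike G → RightStrong 𝒜 H)
proposition2p3 𝒜 G H G≥H = leftStrong , rightStrong
  where
  leftStrong : LeftEndLike H → LeftStrong 𝒜 G
  leftStrong H-end X X∈𝒜 X-end =
    ≥ₒ-preserves-oL≡Left (G≥H X X∈𝒜) (leftEndLike⇒oL≡Left (H + embed X) H+X-end)
    where
    H+X-end : LeftEndLike (H + embed X)
    H+X-end = leftEndLike-+ H (embed X) H-end (embed-leftEnd X X-end)

  rightStrong : RightEndLike G → RightStrong 𝒜 H
  rightStrong G-end X X∈𝒜 X-end =
    ≥ₒ-reflects-oR≡Right (G≥H X X∈𝒜) (rightEndLike⇒oR≡Right (G + embed X) G+X-end)
    where
    G+X-end : RightEndLike (G + embed X)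
    G+X-end = rightEndLike-+ G (embed X) G-end (embed-rightEnd X X-end)
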